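{- Let $G$ be a finite simple graph, let $I$ be a maximum critical independent set in $G$, and set $X=I\cup N(I)$. Then $$|\operatorname{nucleus}(G)|+|\operatorname{diadem}(G)|\le |\operatorname{nucleus}(G[X])|+|\operatorname{diadem}(G[X])|.$$
   Context: $G[X]$ is the induced subgraph on $X$. For a graph $H$ and $Y\subseteq V(H)$, $N_H(Y)$ is the set of neighbors of $Y$ and $d_H(Y)=|Y|-|N_H(Y)|$. A set is independent if no two of its vertices are adjacent. An independent set $B$ of $H$ is critical if $d_H(B)=\max\{d_H(Y):Y\subseteq V(H)\}$; the empty set may be critical. A maximum critical independent set is a critical independent set of maximum cardinality. $\operatorname{diadem}(H)$ is the union, and $\operatorname{nucleus}(H)$ the intersection, of all maximum critical independent sets of $H$. Both are empty if $\emptyset$ is the only critical independent set, in particular for the empty graph. -}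

module Defs where

open import Data.Nat using (ℕ)
open import Data.Bool using (Bool; true; false)
open import Data.Fin using (Fin)
open import Data.Fin.Subset using (Subset; _∈_; _∉_; _⊆_; _∩_; ∣_∣)
open import Data.Fin.Subset.Properties using (_∈?_)
open import Data.Fin.Properties using (any?)
open import Data.Bool.Properties using () renaming (_≟_ to _≟ᵇ_)
open import Data.Vec using (tabulate)
open import Data.Integer using (ℤ; +_; _-_; _≤_)
open import Data.Product using (Σ; _×_; ∃)
open import Relation.Nullary using (does)
open import Relation.Nullary.Decidable using (_×-dec_)
open import Relation.Binary.PropositionalEquality using (_≡_)

record Graph (n : ℕ) : Set where
  field
    adj : Fin n → Fin n → Bool
    adj-sym : ∀ u v → adj u v ≡ adj v u
    adj-irrefl : ∀ v → adj v v ≡ false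
open Graph public

module _ {n : ℕ} (G : Graph n) where

  nbhd : Subset n → Subset n
  nbhd Y = tabulate λ v → does (any? λ u → (u ∈? Y) ×-dec (adj G u v ≟ᵇ true))

  -- Below, W ⊆ V(G) stands for the induced subgraph G[W]:
  -- its vertices are W and N_{G[W]}(Y) = N_G(Y) ∩ W for Y ⊆ W.

  nbhdIn : Subset n → Subset n → Subset n
  nbhdIn W Y = nbhd Y ∩ W

  dIn : Subset n → Subset n → ℤ
  dIn W Y = + ∣ Y ∣ - + ∣ nbhdIn W Y ∣

  Independent : Subset n → Set
  Independent B = ∀ u v → u ∈ B → v ∈ B → adj G u v ≡ false

  CriticalIndepIn : Subset n → Subset n → Set
  CriticalIndepIn W B =
    B ⊆ W × Independent B × (∀ Y → Y ⊆ W → dIn W Y ≤ dIn W B)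

  MaxCriticalIndepIn : Subset n → Subset n → Set
  MaxCriticalIndepIn W B =
    CriticalIndepIn W B × (∀ B' → CriticalIndepIn W B' → ∣ B' ∣ Data.Nat.≤ ∣ B ∣)

  IsDiademIn : Subset n → Subset n → Set
  IsDiademIn W D = ∀ v → (v ∈ D → ∃ λ S → MaxCriticalIndepIn W S × v ∈ S)
                       × ((∃ λ S → MaxCriticalIndepIn W S × v ∈ S) → v ∈ D)

  -- K = nucleus(G[W]) : intersection of all maximum critical independent sets of G[W]
  -- (the family is nonempty, so this is a subset of W)
  IsNucleusIn : Subset n → Subset n → Set
  IsNucleusIn W K = ∀ v → (v ∈ K → ∀ S → MaxCriticalIndepIn W S → v ∈ S)
                        × ((∀ S → MaxCriticalIndepIn W S → v ∈ S) → v ∈ K)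

-- A critical set I satisfies Hall's condition from N(I) into I. With it one shows that every
-- maximum critical independent set of G lies in X = I ∪ N(I) and stays maximum critical in G[X],
-- so nucleus(G) ⊆ I and diadem(G) ⊆ diadem(G[X]). For a maximum critical independent set S of
-- G[X], the part S ∩ N(I) is perfectly matched onto I ∖ S; such matched subsets of N(I) are
-- closed under union, so P' = diadem(G[X]) ∩ N(I) has at most |P'| neighbours in I.
-- A vertex of nucleus(G) ∖ nucleus(G[X]) is one of them, and is not adjacent to
-- P = diadem(G) ∩ N(I), whose at least |P| neighbours in I are neighbours of P' too. Hence
--   |nucleus(G)| + |diadem(G)| ≤ |nucleus(G[X])| + |nucleus(G) ∖ nucleus(G[X])| + |I| + |P|
--                              ≤ |nucleus(G[X])| + |I| + |P'| ≤ |nucleus(G[X])| + |diadem(G[X])|.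
module Submission where

open import Defs
open import Data.Nat using (ℕ; _+_; _≤_)
open import Data.Fin.Subset using (Subset; ⊤; _∪_; ∣_∣)

open import Data.Nat using (suc)
open import Data.Bool using (true; false)
open import Data.Bool.Properties using (¬-not; not-¬; _≟_)
open import Data.Empty using (⊥-elim)
open import Data.Fin using (Fin)
open import Data.Fin.Properties using (any?)
open import Data.Fin.Subset using (_∈_; _∉_; _⊆_; _∩_; _─_) renaming (⊥ to ∅)
open import Data.Fin.Subset.Properties
import Data.Integer as ℤ
import Data.Integer.Properties as ℤ
open import Data.Integer.Tactic.RingSolver using (solve-∀)
open import Data.List using ([]; _∷_; allFin)
open import Data.List.Membership.Propositional using () renaming (_∈_ to _∈ₗ_)
open import Data.List.Membership.Propositional.Properties using (∈-allFin)
open import Data.List.Relation.Unary.Any using () renaming (here to hereₗ; there to thereₗ)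
open import Data.Nat.Properties hiding (_≟_)
open import Algebra.Properties.CommutativeSemigroup +-commutativeSemigroup
  using (x∙yz≈y∙zx; x∙yz≈y∙xz; x∙yz≈xz∙y; xy∙z≈x∙zy; xy∙z≈xz∙y; xy∙z≈yz∙x; interchange)
open import Data.Product using (∃; _×_; _,_; proj₁; proj₂)
open import Data.Sum using (inj₁; inj₂; [_,_]′)
open import Data.Vec using (_∷_; []; here; there)
open import Data.Vec.Properties using (lookup∘tabulate; []=⇒lookup; lookup⇒[]=)
open import Function using (const; id)
open import Function.Bundles using (_⇔_; mk⇔; Equivalence)
open import Relation.Nullary using (Dec; does; yes; no)
open import Relation.Nullary.Decidable using (decidable-stable; dec-true; _×-dec_)
open import Relation.Binary.PropositionalEquality

open Equivalence using (to; from)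

private variable
  n : ℕ
  p q r : Subset n

m-n≤o-p⇔m+p≤o+n : ∀ m n o p → (ℤ.+ m ℤ.- ℤ.+ n ℤ.≤ ℤ.+ o ℤ.- ℤ.+ p) ⇔ (m + p ≤ o + n)
m-n≤o-p⇔m+p≤o+n m n o p = mk⇔
  (λ le → ℤ.drop‿+≤+ (ℤ.i-j≤0⇒i≤j (subst (ℤ._≤ ℤ.0ℤ) difference (ℤ.i≤j⇒i-j≤0 le))))
  (λ le → ℤ.i-j≤0⇒i≤j (subst (ℤ._≤ ℤ.0ℤ) (sym difference) (ℤ.i≤j⇒i-j≤0 (ℤ.+≤+ le))))
  where
  regroup : ∀ a b c d → (a ℤ.- b) ℤ.- (c ℤ.- d) ≡ (a ℤ.+ d) ℤ.- (c ℤ.+ b)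
  regroup = solve-∀
  difference : (ℤ.+ m ℤ.- ℤ.+ n) ℤ.- (ℤ.+ o ℤ.- ℤ.+ p) ≡ ℤ.+ (m + p) ℤ.- ℤ.+ (o + n)
  difference = trans (regroup (ℤ.+ m) (ℤ.+ n) (ℤ.+ o) (ℤ.+ p))
                     (sym (cong₂ ℤ._-_ (ℤ.pos-+ m p) (ℤ.pos-+ o n)))

Disjoint : Subset n → Subset n → Set
Disjoint p q = ∀ {x} → x ∈ p → x ∉ q

x∈p─q⇒x∉q : ∀ {x} → x ∈ p ─ q → x ∉ q
x∈p─q⇒x∉q {p = _ ∷ p} {q = true  ∷ q} ()        here
x∈p─q⇒x∉q {p = _ ∷ p} {q = _     ∷ q} (there h) (there k) = x∈p─q⇒x∉q h k

∪-⊆ : p ⊆ r → q ⊆ r → p ∪ q ⊆ r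
∪-⊆ {p = p} {q = q} p⊆r q⊆r x∈p∪q with x∈p∪q⁻ p q x∈p∪q
... | inj₁ x∈p = p⊆r x∈p
... | inj₂ x∈q = q⊆r x∈q

∩-monoˡ-⊆ : p ⊆ q → p ∩ r ⊆ q ∩ r
∩-monoˡ-⊆ {p = p} {r = r} p⊆q x∈p∩r = let x∈p , x∈r = x∈p∩q⁻ p r x∈p∩r in x∈p∩q⁺ (p⊆q x∈p , x∈r)

∩-monoʳ-⊆ : q ⊆ r → p ∩ q ⊆ p ∩ r
∩-monoʳ-⊆ {q = q} {p = p} q⊆r x∈p∩q = let x∈p , x∈q = x∈p∩q⁻ p q x∈p∩q in x∈p∩q⁺ (x∈p , q⊆r x∈q)

⊆-∩ : p ⊆ q → p ⊆ r → p ⊆ q ∩ r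
⊆-∩ p⊆q p⊆r x∈p = x∈p∩q⁺ (p⊆q x∈p , p⊆r x∈p)

p⊆p∩q∪p─q : ∀ (p q : Subset n) → p ⊆ (p ∩ q) ∪ (p ─ q)
p⊆p∩q∪p─q p q {x} x∈p with x ∈? q
... | yes x∈q = x∈p∪q⁺ (inj₁ (x∈p∩q⁺ (x∈p , x∈q)))
... | no  x∉q = x∈p∪q⁺ (inj₂ (x∈p∧x∉q⇒x∈p─q x∈p x∉q))

p─q⊆r⇒p⊆r∪q : p ─ q ⊆ r → p ⊆ r ∪ q
p─q⊆r⇒p⊆r∪q {p = p} {q = q} p─q⊆r x∈p with x∈p∪q⁻ _ _ (p⊆p∩q∪p─q p q x∈p)
... | inj₁ x∈p∩q = x∈p∪q⁺ (inj₂ (p∩q⊆q p q x∈p∩q))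
... | inj₂ x∈p─q = x∈p∪q⁺ (inj₁ (p─q⊆r x∈p─q))

∣p∪q∣+∣p∩q∣≡∣p∣+∣q∣ : ∀ (p q : Subset n) → ∣ p ∪ q ∣ + ∣ p ∩ q ∣ ≡ ∣ p ∣ + ∣ q ∣
∣p∪q∣+∣p∩q∣≡∣p∣+∣q∣ []          []          = refl
∣p∪q∣+∣p∩q∣≡∣p∣+∣q∣ (true  ∷ p) (true  ∷ q) =
  cong suc (trans (+-suc _ _) (trans (cong suc (∣p∪q∣+∣p∩q∣≡∣p∣+∣q∣ p q)) (sym (+-suc _ _))))
∣p∪q∣+∣p∩q∣≡∣p∣+∣q∣ (true  ∷ p) (false ∷ q) = cong suc (∣p∪q∣+∣p∩q∣≡∣p∣+∣q∣ p q)
∣p∪q∣+∣p∩q∣≡∣p∣+∣q∣ (false ∷ p) (true  ∷ q) =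
  trans (cong suc (∣p∪q∣+∣p∩q∣≡∣p∣+∣q∣ p q)) (sym (+-suc _ _))
∣p∪q∣+∣p∩q∣≡∣p∣+∣q∣ (false ∷ p) (false ∷ q) = ∣p∪q∣+∣p∩q∣≡∣p∣+∣q∣ p q

∣p∪q∣≤∣p∣+∣q∣ : ∀ (p q : Subset n) → ∣ p ∪ q ∣ ≤ ∣ p ∣ + ∣ q ∣
∣p∪q∣≤∣p∣+∣q∣ p q = ≤-trans (m≤m+n _ _) (≤-reflexive (∣p∪q∣+∣p∩q∣≡∣p∣+∣q∣ p q))

p⊆q∪r⇒∣p∣≤∣q∣+∣r∣ : p ⊆ q ∪ r → ∣ p ∣ ≤ ∣ q ∣ + ∣ r ∣
p⊆q∪r⇒∣p∣≤∣q∣+∣r∣ {q = q} {r = r} p⊆q∪r = ≤-trans (p⊆q⇒∣p∣≤∣q∣ p⊆q∪r) (∣p∪q∣≤∣p∣+∣q∣ q r)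

∣p∣≤∣p∩q∣+∣p─q∣ : ∀ (p q : Subset n) → ∣ p ∣ ≤ ∣ p ∩ q ∣ + ∣ p ─ q ∣
∣p∣≤∣p∩q∣+∣p─q∣ p q = p⊆q∪r⇒∣p∣≤∣q∣+∣r∣ (p⊆p∩q∪p─q p q)

p⊆q∪r⇒∣p∣≤∣p∩q∣+∣p∩r∣ : p ⊆ q ∪ r → ∣ p ∣ ≤ ∣ p ∩ q ∣ + ∣ p ∩ r ∣
p⊆q∪r⇒∣p∣≤∣p∩q∣+∣p∩r∣ {p = p} {q = q} {r = r} p⊆q∪r = p⊆q∪r⇒∣p∣≤∣q∣+∣r∣ split
  where
  split : p ⊆ (p ∩ q) ∪ (p ∩ r)
  split x∈p with x∈p∪q⁻ q r (p⊆q∪r x∈p)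
  ... | inj₁ x∈q = x∈p∪q⁺ (inj₁ (x∈p∩q⁺ (x∈p , x∈q)))
  ... | inj₂ x∈r = x∈p∪q⁺ (inj₂ (x∈p∩q⁺ (x∈p , x∈r)))

Disjoint⇒∣p∪q∣≡∣p∣+∣q∣ : Disjoint p q → ∣ p ∪ q ∣ ≡ ∣ p ∣ + ∣ q ∣
Disjoint⇒∣p∪q∣≡∣p∣+∣q∣ {n} {p} {q} p#q = begin
  ∣ p ∪ q ∣                ≡⟨ sym (+-identityʳ _) ⟩
  ∣ p ∪ q ∣ + 0            ≡⟨ cong (∣ p ∪ q ∣ +_) (sym ∣p∩q∣≡0) ⟩
  ∣ p ∪ q ∣ + ∣ p ∩ q ∣    ≡⟨ ∣p∪q∣+∣p∩q∣≡∣p∣+∣q∣ p q ⟩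
  ∣ p ∣ + ∣ q ∣            ∎
  where
  open ≡-Reasoning
  ∣p∩q∣≡0 : ∣ p ∩ q ∣ ≡ 0
  ∣p∩q∣≡0 = trans (cong ∣_∣ (Empty-unique λ (_ , x∈p∩q) → let x∈p , x∈q = x∈p∩q⁻ p q x∈p∩q in p#q x∈p x∈q))
                  (∣⊥∣≡0 n)

Disjoint⇒∣p∣+∣q∣≤∣r∣ : p ⊆ r → q ⊆ r → Disjoint p q → ∣ p ∣ + ∣ q ∣ ≤ ∣ r ∣
Disjoint⇒∣p∣+∣q∣≤∣r∣ p⊆r q⊆r p#q =
  ≤-trans (≤-reflexive (sym (Disjoint⇒∣p∪q∣≡∣p∣+∣q∣ p#q))) (p⊆q⇒∣p∣≤∣q∣ (∪-⊆ p⊆r q⊆r))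

p⊆q∧∣q∣≤∣p∣⇒q⊆p : p ⊆ q → ∣ q ∣ ≤ ∣ p ∣ → q ⊆ p
p⊆q∧∣q∣≤∣p∣⇒q⊆p {p = p} p⊆q ∣q∣≤∣p∣ {x} x∈q with x ∈? p
... | yes x∈p = x∈p
... | no  x∉p = ⊥-elim (<⇒≱ (p⊂q⇒∣p∣<∣q∣ (p⊆q , x , x∈q , x∉p)) ∣q∣≤∣p∣)

∪-closed-cover : (P : Subset n → Set) → P ∅ → (∀ {p q} → P p → P q → P (p ∪ q)) →
  ∀ U → (∀ {x} → x ∈ U → ∃ λ p → P p × x ∈ p × p ⊆ U) → P U
∪-closed-cover {n} P P∅ P∪ U cover =
  let p , Pp , p⊆U , U⊆p = collect (allFin n)
  in subst P (⊆-antisym p⊆U λ x∈U → U⊆p (∈-allFin _) x∈U) Pp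
  where
  witness : ∀ x → ∃ λ p → P p × p ⊆ U × (x ∈ U → x ∈ p)
  witness x with x ∈? U
  ... | yes x∈U = let p , Pp , x∈p , p⊆U = cover x∈U in p , Pp , p⊆U , const x∈p
  ... | no  x∉U = ∅ , P∅ , ⊥⊆ , λ x∈U → ⊥-elim (x∉U x∈U)
  collect : ∀ xs → ∃ λ p → P p × p ⊆ U × (∀ {x} → x ∈ₗ xs → x ∈ U → x ∈ p)
  collect []       = ∅ , P∅ , ⊥⊆ , λ ()
  collect (x ∷ xs) =
    let p , Pp , p⊆U , x∈p = witness x
        q , Pq , q⊆U , xs⊆q = collect xs
    in p ∪ q , P∪ Pp Pq , ∪-⊆ p⊆U q⊆U ,
       λ { (hereₗ refl) y∈U → x∈p∪q⁺ (inj₁ (x∈p y∈U))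
         ; (thereₗ y∈xs) y∈U → x∈p∪q⁺ (inj₂ (xs⊆q y∈xs y∈U)) }

does≡true⇒ : ∀ {P : Set} (P? : Dec P) → does P? ≡ true → P
does≡true⇒ (yes p) _ = p

module _ {n : ℕ} (G : Graph n) where

  private
    N = nbhd G
    variable
      u v : Fin n
      A B D D' K K' S W Y Z : Subset n

  private
    adjacent? : ∀ Y v → Dec (∃ λ u → u ∈ Y × adj G u v ≡ true)
    adjacent? Y v = any? λ u → (u ∈? Y) ×-dec (adj G u v ≟ true)

  ∈-nbhd⁻ : v ∈ N Y → ∃ λ u → u ∈ Y × adj G u v ≡ true
  ∈-nbhd⁻ {v} {Y} v∈NY =
    does≡true⇒ (adjacent? Y v) (trans (sym (lookup∘tabulate _ v)) ([]=⇒lookup v∈NY))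

  ∈-nbhd⁺ : u ∈ Y → adj G u v ≡ true → v ∈ N Y
  ∈-nbhd⁺ {u} {Y} {v} u∈Y uv =
    lookup⇒[]= v _ (trans (lookup∘tabulate _ v) (dec-true (adjacent? Y v) (u , u∈Y , uv)))

  nbhd-mono : A ⊆ B → N A ⊆ N B
  nbhd-mono A⊆B v∈NA = let u , u∈A , uv = ∈-nbhd⁻ v∈NA in ∈-nbhd⁺ (A⊆B u∈A) uv

  nbhd-∪ : ∀ A B → N (A ∪ B) ⊆ N A ∪ N B
  nbhd-∪ A B v∈N with ∈-nbhd⁻ v∈N
  ... | u , u∈A∪B , uv with x∈p∪q⁻ A B u∈A∪B
  ...   | inj₁ u∈A = x∈p∪q⁺ (inj₁ (∈-nbhd⁺ u∈A uv))
  ...   | inj₂ u∈B = x∈p∪q⁺ (inj₂ (∈-nbhd⁺ u∈B uv))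

  nbhdIn-submodular : ∀ W A B →
    ∣ nbhdIn G W (A ∪ B) ∣ + ∣ nbhdIn G W (A ∩ B) ∣ ≤ ∣ nbhdIn G W A ∣ + ∣ nbhdIn G W B ∣
  nbhdIn-submodular W A B = begin
    ∣ nbhdIn G W (A ∪ B) ∣ + ∣ nbhdIn G W (A ∩ B) ∣
      ≤⟨ +-mono-≤ (p⊆q⇒∣p∣≤∣q∣ ∪-part) (p⊆q⇒∣p∣≤∣q∣ ∩-part) ⟩
    ∣ nbhdIn G W A ∪ nbhdIn G W B ∣ + ∣ nbhdIn G W A ∩ nbhdIn G W B ∣
      ≡⟨ ∣p∪q∣+∣p∩q∣≡∣p∣+∣q∣ (nbhdIn G W A) (nbhdIn G W B) ⟩
    ∣ nbhdIn G W A ∣ + ∣ nbhdIn G W B ∣ ∎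
    where
    open ≤-Reasoning
    ∪-part : nbhdIn G W (A ∪ B) ⊆ nbhdIn G W A ∪ nbhdIn G W B
    ∪-part = subst (nbhdIn G W (A ∪ B) ⊆_) (∩-distribʳ-∪ W (N A) (N B)) (∩-monoˡ-⊆ (nbhd-∪ A B))
    ∩-part : nbhdIn G W (A ∩ B) ⊆ nbhdIn G W A ∩ nbhdIn G W B
    ∩-part = ⊆-∩ (∩-monoˡ-⊆ (nbhd-mono (p∩q⊆p A B))) (∩-monoˡ-⊆ (nbhd-mono (p∩q⊆q A B)))

  nbhdIn⊆nbhdIn⊤ : ∀ W Y → nbhdIn G W Y ⊆ nbhdIn G ⊤ Y
  nbhdIn⊆nbhdIn⊤ W Y = ∩-monoʳ-⊆ ⊆⊤

  Independent⇒Disjoint-nbhd : Independent G B → Disjoint B (N B)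
  Independent⇒Disjoint-nbhd B-ind {v} v∈B v∈NB =
    let u , u∈B , uv = ∈-nbhd⁻ v∈NB in not-¬ (B-ind u v u∈B v∈B) uv

  Disjoint-nbhd-sym : Disjoint A (N B) → Disjoint B (N A)
  Disjoint-nbhd-sym A#NB {v} v∈B v∈NA =
    let u , u∈A , uv = ∈-nbhd⁻ v∈NA in A#NB u∈A (∈-nbhd⁺ v∈B (trans (adj-sym G v u) uv))

  Independent-∪ : Independent G A → Independent G B → Disjoint A (N B) → Independent G (A ∪ B)
  Independent-∪ {A} {B} A-ind B-ind A#NB u v u∈A∪B v∈A∪B with x∈p∪q⁻ A B u∈A∪B | x∈p∪q⁻ A B v∈A∪B
  ... | inj₁ u∈A | inj₁ v∈A = A-ind u v u∈A v∈A
  ... | inj₁ u∈A | inj₂ v∈B = ¬-not λ uv → A#NB u∈A (∈-nbhd⁺ v∈B (trans (adj-sym G v u) uv))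
  ... | inj₂ u∈B | inj₁ v∈A = ¬-not λ uv → A#NB v∈A (∈-nbhd⁺ u∈B uv)
  ... | inj₂ u∈B | inj₂ v∈B = B-ind u v u∈B v∈B

  infix 4 _≤ᵈ⟨_⟩_

  -- d_{G[W]}(Y) ≤ d_{G[W]}(S), with the subtracted terms moved across the inequality
  _≤ᵈ⟨_⟩_ : Subset n → Subset n → Subset n → Set
  Y ≤ᵈ⟨ W ⟩ S = ∣ Y ∣ + ∣ nbhdIn G W S ∣ ≤ ∣ S ∣ + ∣ nbhdIn G W Y ∣

  dIn-≤⇔≤ᵈ : ∀ W Y S → (dIn G W Y ℤ.≤ dIn G W S) ⇔ (Y ≤ᵈ⟨ W ⟩ S)
  dIn-≤⇔≤ᵈ W Y S = m-n≤o-p⇔m+p≤o+n (∣ Y ∣) (∣ nbhdIn G W Y ∣) (∣ S ∣) (∣ nbhdIn G W S ∣)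

  ≤ᵈ-trans : Y ≤ᵈ⟨ W ⟩ S → S ≤ᵈ⟨ W ⟩ Z → Y ≤ᵈ⟨ W ⟩ Z
  ≤ᵈ-trans {Y} {W} {S} {Z} Y≤S S≤Z = +-cancelʳ-≤ s (y + nz) (z + ny) (begin
    (y + nz) + s  ≡⟨ xy∙z≈x∙zy y nz s ⟩
    y + (s + nz)  ≤⟨ +-monoʳ-≤ y S≤Z ⟩
    y + (z + ns)  ≡⟨ x∙yz≈y∙xz y z ns ⟩
    z + (y + ns)  ≤⟨ +-monoʳ-≤ z Y≤S ⟩
    z + (s + ny)  ≡⟨ x∙yz≈xz∙y z s ny ⟩
    (z + ny) + s  ∎)
    where
    open ≤-Reasoning
    y = ∣ Y ∣ ; s = ∣ S ∣ ; z = ∣ Z ∣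
    ny = ∣ nbhdIn G W Y ∣ ; ns = ∣ nbhdIn G W S ∣ ; nz = ∣ nbhdIn G W Z ∣

  -- Supermodularity of d_{G[W]}.
  ≤ᵈ-∪ : ∀ W A B → A ∩ B ≤ᵈ⟨ W ⟩ B → A ≤ᵈ⟨ W ⟩ A ∪ B
  ≤ᵈ-∪ W A B A∩B≤B = +-cancelʳ-≤ (d + nb) (a + nc) (c + na) (begin
    (a + nc) + (d + nb)  ≤⟨ +-monoʳ-≤ (a + nc) A∩B≤B ⟩
    (a + nc) + (b + nd)  ≡⟨ interchange a nc b nd ⟩
    (a + b) + (nc + nd)  ≤⟨ +-monoʳ-≤ (a + b) (nbhdIn-submodular W A B) ⟩
    (a + b) + (na + nb)  ≡⟨ cong (_+ (na + nb)) (∣p∪q∣+∣p∩q∣≡∣p∣+∣q∣ A B) ⟨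
    (c + d) + (na + nb)  ≡⟨ interchange c d na nb ⟩
    (c + na) + (d + nb)  ∎)
    where
    open ≤-Reasoning
    a = ∣ A ∣ ; b = ∣ B ∣ ; c = ∣ A ∪ B ∣ ; d = ∣ A ∩ B ∣
    na = ∣ nbhdIn G W A ∣ ; nb = ∣ nbhdIn G W B ∣
    nc = ∣ nbhdIn G W (A ∪ B) ∣ ; nd = ∣ nbhdIn G W (A ∩ B) ∣

  Critical : Subset n → Subset n → Set
  Critical W S = ∀ Y → Y ⊆ W → Y ≤ᵈ⟨ W ⟩ S

  CriticalIndepIn⇒Critical : CriticalIndepIn G W S → Critical W S
  CriticalIndepIn⇒Critical {W} (_ , _ , S-crit) Y Y⊆W = dIn-≤⇔≤ᵈ W Y _ .to (S-crit Y Y⊆W)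

  Critical⇒CriticalIndepIn : S ⊆ W → Independent G S → Critical W S → CriticalIndepIn G W S
  Critical⇒CriticalIndepIn {W = W} S⊆W S-ind S-crit =
    S⊆W , S-ind , λ Y Y⊆W → dIn-≤⇔≤ᵈ W Y _ .from (S-crit Y Y⊆W)

  Critical-∪ : B ⊆ W → Critical W A → Critical W B → Critical W (A ∪ B)
  Critical-∪ {B} {W} {A} B⊆W A-crit B-crit Y Y⊆W =
    ≤ᵈ-trans (A-crit Y Y⊆W) (≤ᵈ-∪ W A B (B-crit (A ∩ B) λ x∈A∩B → B⊆W (p∩q⊆q A B x∈A∩B)))

  -- Hall's condition: N_{G[W]}(S) can be matched into S.
  Critical⇒hall : S ⊆ W → Critical W S → Z ⊆ nbhdIn G W S → ∣ Z ∣ ≤ ∣ nbhdIn G S Z ∣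
  Critical⇒hall {S} {W} {Z} S⊆W S-crit Z⊆NS = +-cancelʳ-≤ (t + ns) z k (begin
    z + (t + ns)  ≤⟨ +-monoʳ-≤ z (S-crit T λ x∈T → S⊆W (p─q⊆p S (N Z) x∈T)) ⟩
    z + (s + nt)  ≡⟨ x∙yz≈y∙zx z s nt ⟩
    s + (nt + z)  ≤⟨ +-monoʳ-≤ s nt+z≤ns ⟩
    s + ns        ≤⟨ +-monoˡ-≤ ns s≤k+t ⟩
    (k + t) + ns  ≡⟨ +-assoc k t ns ⟩
    k + (t + ns)  ∎)
    where
    open ≤-Reasoning
    T = S ─ N Z
    z = ∣ Z ∣ ; t = ∣ T ∣ ; s = ∣ S ∣ ; k = ∣ nbhdIn G S Z ∣
    nt = ∣ nbhdIn G W T ∣ ; ns = ∣ nbhdIn G W S ∣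
    nt+z≤ns : nt + z ≤ ns
    nt+z≤ns = Disjoint⇒∣p∣+∣q∣≤∣r∣ (∩-monoˡ-⊆ (nbhd-mono (p─q⊆p S (N Z)))) Z⊆NS
      λ v∈NT v∈Z → Disjoint-nbhd-sym x∈p─q⇒x∉q v∈Z (proj₁ (x∈p∩q⁻ _ _ v∈NT))
    s≤k+t : s ≤ k + t
    s≤k+t = ≤-trans (∣p∣≤∣p∩q∣+∣p─q∣ S (N Z)) (≤-reflexive (cong (λ i → ∣ i ∣ + t) (∩-comm S (N Z))))

  nucleus⊆maxCritical : IsNucleusIn G W K → MaxCriticalIndepIn G W S → K ⊆ S
  nucleus⊆maxCritical K-nucleus S-max {v} v∈K = proj₁ (K-nucleus v) v∈K _ S-max

  maxCritical⊆diadem : IsDiademIn G W D → MaxCriticalIndepIn G W S → S ⊆ D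
  maxCritical⊆diadem D-diadem S-max {v} v∈S = proj₂ (D-diadem v) (_ , S-max , v∈S)

  nucleus-Disjoint-nbhd-diadem : IsNucleusIn G W K → IsDiademIn G W D → Disjoint K (N D)
  nucleus-Disjoint-nbhd-diadem K-nucleus D-diadem v∈K v∈ND =
    let u , u∈D , uv = ∈-nbhd⁻ v∈ND
        S , S-max , u∈S = proj₁ (D-diadem u) u∈D
        S-ind = proj₁ (proj₂ (proj₁ S-max))
    in Independent⇒Disjoint-nbhd S-ind (nucleus⊆maxCritical K-nucleus S-max v∈K) (∈-nbhd⁺ u∈S uv)

  module MaximumCritical {I : Subset n} (I-max : MaxCriticalIndepIn G ⊤ I) where

    NI : Subset n
    NI = N I

    X : Subset n
    X = I ∪ NI

    I-independent : Independent G I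
    I-independent = proj₁ (proj₂ (proj₁ I-max))

    I-critical : Critical ⊤ I
    I-critical = CriticalIndepIn⇒Critical (proj₁ I-max)

    I#NI : Disjoint I NI
    I#NI = Independent⇒Disjoint-nbhd I-independent

    hall : Z ⊆ NI → ∣ Z ∣ ≤ ∣ nbhdIn G I Z ∣
    hall Z⊆NI = Critical⇒hall ⊆⊤ I-critical λ v∈Z → x∈p∩q⁺ (Z⊆NI v∈Z , ∈⊤)

    independent-split : Independent G B → Disjoint (B ∩ I) (nbhdIn G I (B ∩ NI))
    independent-split B-ind v∈B∩I v∈N =
      Independent⇒Disjoint-nbhd B-ind (p∩q⊆p _ I v∈B∩I) (nbhd-mono (p∩q⊆p _ NI) (proj₁ (x∈p∩q⁻ _ _ v∈N)))

    independent-split-≤∣I∣ : Independent G B → ∣ B ∩ I ∣ + ∣ nbhdIn G I (B ∩ NI) ∣ ≤ ∣ I ∣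
    independent-split-≤∣I∣ {B} B-ind =
      Disjoint⇒∣p∣+∣q∣≤∣r∣ (p∩q⊆q B I) (p∩q⊆q _ I) (independent-split B-ind)

    independent⊆X⇒∣B∣≤∣I∣ : B ⊆ X → Independent G B → ∣ B ∣ ≤ ∣ I ∣
    independent⊆X⇒∣B∣≤∣I∣ {B} B⊆X B-ind = begin
      ∣ B ∣                                 ≤⟨ p⊆q∪r⇒∣p∣≤∣p∩q∣+∣p∩r∣ B⊆X ⟩
      ∣ B ∩ I ∣ + ∣ B ∩ NI ∣                ≤⟨ +-monoʳ-≤ (∣ B ∩ I ∣) (hall (p∩q⊆q B NI)) ⟩
      ∣ B ∩ I ∣ + ∣ nbhdIn G I (B ∩ NI) ∣   ≤⟨ independent-split-≤∣I∣ B-ind ⟩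
      ∣ I ∣                                 ∎
      where open ≤-Reasoning

    I-critical-in-X : Critical X I
    I-critical-in-X Y Y⊆X = begin
      y + ∣ nbhdIn G X I ∣
        ≤⟨ +-mono-≤ (p⊆q∪r⇒∣p∣≤∣p∩q∣+∣p∩r∣ Y⊆X) (p⊆q⇒∣p∣≤∣q∣ (nbhdIn⊆nbhdIn⊤ X I)) ⟩
      (y₁ + y₂) + ni       ≡⟨ xy∙z≈xz∙y y₁ y₂ ni ⟩
      (y₁ + ni) + y₂       ≤⟨ +-mono-≤ (I-critical (Y ∩ I) ⊆⊤) (hall (p∩q⊆q Y NI)) ⟩
      (∣ I ∣ + n₁) + n₂    ≡⟨ +-assoc (∣ I ∣) n₁ n₂ ⟩
      ∣ I ∣ + (n₁ + n₂)    ≤⟨ +-monoʳ-≤ (∣ I ∣) (Disjoint⇒∣p∣+∣q∣≤∣r∣ N₁⊆ N₂⊆ N₁#N₂) ⟩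
      ∣ I ∣ + ∣ nbhdIn G X Y ∣ ∎
      where
      open ≤-Reasoning
      y = ∣ Y ∣ ; y₁ = ∣ Y ∩ I ∣ ; y₂ = ∣ Y ∩ NI ∣ ; ni = ∣ nbhdIn G ⊤ I ∣
      n₁ = ∣ nbhdIn G ⊤ (Y ∩ I) ∣ ; n₂ = ∣ nbhdIn G I (Y ∩ NI) ∣
      N₁⊆ : nbhdIn G ⊤ (Y ∩ I) ⊆ nbhdIn G X Y
      N₁⊆ v∈ = let v∈N , _ = x∈p∩q⁻ _ _ v∈ in
        x∈p∩q⁺ (nbhd-mono (p∩q⊆p Y I) v∈N , q⊆p∪q I NI (nbhd-mono (p∩q⊆q Y I) v∈N))
      N₂⊆ : nbhdIn G I (Y ∩ NI) ⊆ nbhdIn G X Y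
      N₂⊆ = ⊆-∩ (λ v∈ → nbhd-mono (p∩q⊆p Y NI) (proj₁ (x∈p∩q⁻ _ _ v∈))) λ v∈ → p⊆p∪q NI (p∩q⊆q _ I v∈)
      N₁#N₂ : Disjoint (nbhdIn G ⊤ (Y ∩ I)) (nbhdIn G I (Y ∩ NI))
      N₁#N₂ v∈N₁ v∈N₂ = I#NI (p∩q⊆q _ I v∈N₂) (nbhd-mono (p∩q⊆q Y I) (proj₁ (x∈p∩q⁻ _ _ v∈N₁)))

    I-maxCritical-in-X : MaxCriticalIndepIn G X I
    I-maxCritical-in-X = Critical⇒CriticalIndepIn (p⊆p∪q NI) I-independent I-critical-in-X ,
                         λ B (B⊆X , B-ind , _) → independent⊆X⇒∣B∣≤∣I∣ B⊆X B-ind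

    maxCritical─NI⊆I : MaxCriticalIndepIn G ⊤ S → S ─ NI ⊆ I
    maxCritical─NI⊆I {S} (S-critical-indep@(_ , S-ind , _) , _) v∈T = T∪I⊆I (p⊆p∪q I v∈T)
      where
      T = S ─ NI
      P = S ∩ NI
      T#NI : Disjoint T NI
      T#NI = x∈p─q⇒x∉q
      I≤ᵈT : I ≤ᵈ⟨ ⊤ ⟩ T
      I≤ᵈT = +-cancelʳ-≤ k (∣ I ∣ + nt) (∣ T ∣ + ni) (begin
        (∣ I ∣ + nt) + k      ≡⟨ +-assoc (∣ I ∣) nt k ⟩
        ∣ I ∣ + (nt + k)      ≤⟨ +-monoʳ-≤ (∣ I ∣) nt+k≤ns ⟩
        ∣ I ∣ + ns            ≤⟨ CriticalIndepIn⇒Critical S-critical-indep I ⊆⊤ ⟩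
        ∣ S ∣ + ni            ≤⟨ +-monoˡ-≤ ni (∣p∣≤∣p∩q∣+∣p─q∣ S NI) ⟩
        (∣ P ∣ + ∣ T ∣) + ni  ≤⟨ +-monoˡ-≤ ni (+-monoˡ-≤ (∣ T ∣) (hall (p∩q⊆q S NI))) ⟩
        (k + ∣ T ∣) + ni      ≡⟨ xy∙z≈yz∙x k (∣ T ∣) ni ⟩
        (∣ T ∣ + ni) + k      ∎)
        where
        open ≤-Reasoning
        k = ∣ nbhdIn G I P ∣
        nt = ∣ nbhdIn G ⊤ T ∣ ; ns = ∣ nbhdIn G ⊤ S ∣ ; ni = ∣ nbhdIn G ⊤ I ∣
        nt+k≤ns : nt + k ≤ ns
        nt+k≤ns = Disjoint⇒∣p∣+∣q∣≤∣r∣ (∩-monoˡ-⊆ (nbhd-mono (p─q⊆p S NI)))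
          (λ v∈ → x∈p∩q⁺ (nbhd-mono (p∩q⊆p S NI) (proj₁ (x∈p∩q⁻ _ _ v∈)) , ∈⊤))
          (λ v∈NT v∈NP → Disjoint-nbhd-sym T#NI (p∩q⊆q _ I v∈NP) (proj₁ (x∈p∩q⁻ _ _ v∈NT)))
      T∪I-critical-indep : CriticalIndepIn G ⊤ (T ∪ I)
      T∪I-critical-indep = Critical⇒CriticalIndepIn ⊆⊤
        (Independent-∪ (λ u v u∈T v∈T → S-ind u v (p─q⊆p S NI u∈T) (p─q⊆p S NI v∈T)) I-independent T#NI)
        (Critical-∪ ⊆⊤ (λ Y _ → ≤ᵈ-trans (I-critical Y ⊆⊤) I≤ᵈT) I-critical)
      T∪I⊆I : T ∪ I ⊆ I
      T∪I⊆I = p⊆q∧∣q∣≤∣p∣⇒q⊆p (q⊆p∪q T I) (proj₂ I-max (T ∪ I) T∪I-critical-indep)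

    maxCritical⊆X : MaxCriticalIndepIn G ⊤ S → S ⊆ X
    maxCritical⊆X S-max = p─q⊆r⇒p⊆r∪q (maxCritical─NI⊆I S-max)

    nbhdIn⊤-I⊆nbhdIn-X : nbhdIn G ⊤ I ⊆ nbhdIn G X I
    nbhdIn⊤-I⊆nbhdIn-X = ⊆-∩ (p∩q⊆p NI ⊤) λ v∈ → q⊆p∪q I NI (p∩q⊆p NI ⊤ v∈)

    maxCritical⇒maxCritical-in-X : MaxCriticalIndepIn G ⊤ S → MaxCriticalIndepIn G X S
    maxCritical⇒maxCritical-in-X {S} S-max@(S-critical-indep@(_ , S-ind , _) , S-maximum) =
      Critical⇒CriticalIndepIn (maxCritical⊆X S-max) S-ind
        (λ Y Y⊆X → ≤ᵈ-trans (I-critical-in-X Y Y⊆X) I≤ᵈS) ,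
      λ B (B⊆X , B-ind , _) → ≤-trans (independent⊆X⇒∣B∣≤∣I∣ B⊆X B-ind) (S-maximum I (proj₁ I-max))
      where
      open ≤-Reasoning
      I≤ᵈS : I ≤ᵈ⟨ X ⟩ S
      I≤ᵈS = begin
        ∣ I ∣ + ∣ nbhdIn G X S ∣  ≤⟨ +-monoʳ-≤ (∣ I ∣) (p⊆q⇒∣p∣≤∣q∣ (nbhdIn⊆nbhdIn⊤ X S)) ⟩
        ∣ I ∣ + ∣ nbhdIn G ⊤ S ∣  ≤⟨ CriticalIndepIn⇒Critical S-critical-indep I ⊆⊤ ⟩
        ∣ S ∣ + ∣ nbhdIn G ⊤ I ∣  ≤⟨ +-monoʳ-≤ (∣ S ∣) (p⊆q⇒∣p∣≤∣q∣ nbhdIn⊤-I⊆nbhdIn-X) ⟩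
        ∣ S ∣ + ∣ nbhdIn G X I ∣  ∎

    ∣I∣≤∣S∩I∣+∣S∩NI∣ : MaxCriticalIndepIn G X S → ∣ I ∣ ≤ ∣ S ∩ I ∣ + ∣ S ∩ NI ∣
    ∣I∣≤∣S∩I∣+∣S∩NI∣ ((S⊆X , _) , S-maximum) =
      ≤-trans (S-maximum I (proj₁ I-maxCritical-in-X)) (p⊆q∪r⇒∣p∣≤∣p∩q∣+∣p∩r∣ S⊆X)

    -- Together with hall: Z is perfectly matched onto its neighbours in I.
    Tight : Subset n → Set
    Tight Z = Z ⊆ NI × ∣ nbhdIn G I Z ∣ ≤ ∣ Z ∣

    Tight-∅ : Tight ∅
    Tight-∅ = ⊥⊆ , p⊆q⇒∣p∣≤∣q∣ {p = nbhdIn G I ∅} {q = ∅}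
      λ v∈ → ⊥-elim (∉⊥ (proj₁ (proj₂ (∈-nbhd⁻ (p∩q⊆p (N ∅) I v∈)))))

    Tight-∪ : Tight A → Tight B → Tight (A ∪ B)
    Tight-∪ {A} {B} (A⊆NI , A-tight) (B⊆NI , B-tight) =
      ∪-⊆ A⊆NI B⊆NI , +-cancelʳ-≤ (∣ A ∩ B ∣) (∣ nbhdIn G I (A ∪ B) ∣) (∣ A ∪ B ∣) (begin
        ∣ nbhdIn G I (A ∪ B) ∣ + ∣ A ∩ B ∣
          ≤⟨ +-monoʳ-≤ (∣ nbhdIn G I (A ∪ B) ∣) (hall λ v∈ → A⊆NI (p∩q⊆p A B v∈)) ⟩
        ∣ nbhdIn G I (A ∪ B) ∣ + ∣ nbhdIn G I (A ∩ B) ∣ ≤⟨ nbhdIn-submodular I A B ⟩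
        ∣ nbhdIn G I A ∣ + ∣ nbhdIn G I B ∣              ≤⟨ +-mono-≤ A-tight B-tight ⟩
        ∣ A ∣ + ∣ B ∣                                    ≡⟨ ∣p∪q∣+∣p∩q∣≡∣p∣+∣q∣ A B ⟨
        ∣ A ∪ B ∣ + ∣ A ∩ B ∣                            ∎)
      where open ≤-Reasoning

    maxCritical-in-X⇒Tight : MaxCriticalIndepIn G X S → Tight (S ∩ NI)
    maxCritical-in-X⇒Tight {S} S-max = p∩q⊆q S NI ,
      +-cancelˡ-≤ (∣ S ∩ I ∣) _ _ (≤-trans (independent-split-≤∣I∣ S-ind) (∣I∣≤∣S∩I∣+∣S∩NI∣ S-max))
      where S-ind = proj₁ (proj₂ (proj₁ S-max))

    maxCritical-in-X-covers-I : MaxCriticalIndepIn G X S → I ⊆ S ∪ N (S ∩ NI)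
    maxCritical-in-X-covers-I {S} S-max v∈I =
      ∪-⊆ (λ v∈ → p⊆p∪q _ (p∩q⊆p S I v∈)) (λ v∈ → q⊆p∪q S _ (p∩q⊆p _ I v∈)) (I⊆C v∈I)
      where
      open ≤-Reasoning
      S-ind = proj₁ (proj₂ (proj₁ S-max))
      C = (S ∩ I) ∪ nbhdIn G I (S ∩ NI)
      I⊆C : I ⊆ C
      I⊆C = p⊆q∧∣q∣≤∣p∣⇒q⊆p (∪-⊆ (p∩q⊆q S I) (p∩q⊆q _ I)) (begin
        ∣ I ∣                                ≤⟨ ∣I∣≤∣S∩I∣+∣S∩NI∣ S-max ⟩
        ∣ S ∩ I ∣ + ∣ S ∩ NI ∣                ≤⟨ +-monoʳ-≤ (∣ S ∩ I ∣) (hall (p∩q⊆q S NI)) ⟩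
        ∣ S ∩ I ∣ + ∣ nbhdIn G I (S ∩ NI) ∣   ≡⟨ Disjoint⇒∣p∪q∣≡∣p∣+∣q∣ (independent-split S-ind) ⟨
        ∣ C ∣                                ∎)

    diadem-in-X⇒Tight : IsDiademIn G X D → Tight (D ∩ NI)
    diadem-in-X⇒Tight {D} D-diadem = ∪-closed-cover Tight Tight-∅ Tight-∪ (D ∩ NI) λ v∈ →
      let v∈D , v∈NI = x∈p∩q⁻ D NI v∈
          S , S-max , v∈S = proj₁ (D-diadem _) v∈D
      in S ∩ NI , maxCritical-in-X⇒Tight S-max , x∈p∩q⁺ (v∈S , v∈NI) ,
         ∩-monoˡ-⊆ (maxCritical⊆diadem D-diadem S-max)

    diadem⊆diadem-in-X : IsDiademIn G ⊤ D → IsDiademIn G X D' → D ⊆ D'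
    diadem⊆diadem-in-X D-diadem D'-diadem v∈D =
      let S , S-max , v∈S = proj₁ (D-diadem _) v∈D
      in maxCritical⊆diadem D'-diadem (maxCritical⇒maxCritical-in-X S-max) v∈S

    diadem⊆X : IsDiademIn G ⊤ D → D ⊆ X
    diadem⊆X D-diadem v∈D = let S , S-max , v∈S = proj₁ (D-diadem _) v∈D in maxCritical⊆X S-max v∈S

    nucleus─nucleus-in-X⊆nbhd : IsNucleusIn G ⊤ K → IsNucleusIn G X K' → IsDiademIn G X D' →
      K ─ K' ⊆ N (D' ∩ NI)
    nucleus─nucleus-in-X⊆nbhd {K} {K'} {D'} K-nucleus K'-nucleus D'-diadem {v} v∈K─K' =
      decidable-stable (v ∈? N (D' ∩ NI)) λ v∉N →
        x∈p─q⇒x∉q v∈K─K' (proj₂ (K'-nucleus v) (in-every-maxCritical v∉N))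
      where
      v∈I : v ∈ I
      v∈I = nucleus⊆maxCritical K-nucleus I-max (p─q⊆p K K' v∈K─K')
      in-every-maxCritical : v ∉ N (D' ∩ NI) → ∀ S → MaxCriticalIndepIn G X S → v ∈ S
      in-every-maxCritical v∉N S S-max =
        [ id , (λ v∈N → ⊥-elim (v∉N (nbhd-mono (∩-monoˡ-⊆ (maxCritical⊆diadem D'-diadem S-max)) v∈N))) ]′
          (x∈p∪q⁻ S (N (S ∩ NI)) (maxCritical-in-X-covers-I S-max v∈I))

    ∣D∣≤∣I∣+∣D∩NI∣ : IsDiademIn G ⊤ D → ∣ D ∣ ≤ ∣ I ∣ + ∣ D ∩ NI ∣
    ∣D∣≤∣I∣+∣D∩NI∣ {D} D-diadem =
      ≤-trans (p⊆q∪r⇒∣p∣≤∣p∩q∣+∣p∩r∣ (diadem⊆X D-diadem)) (+-monoˡ-≤ ∣ D ∩ NI ∣ (∣p∩q∣≤∣q∣ D I))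

    ∣I∣+∣D∩NI∣≤∣D∣ : IsDiademIn G X D → ∣ I ∣ + ∣ D ∩ NI ∣ ≤ ∣ D ∣
    ∣I∣+∣D∩NI∣≤∣D∣ {D} D-diadem =
      Disjoint⇒∣p∣+∣q∣≤∣r∣ (maxCritical⊆diadem D-diadem I-maxCritical-in-X) (p∩q⊆p D NI)
        λ v∈I v∈D∩NI → I#NI v∈I (p∩q⊆q D NI v∈D∩NI)

    ∣K─K'∣+∣N[D∩NI]∩I∣≤∣D'∩NI∣ : IsNucleusIn G ⊤ K → IsDiademIn G ⊤ D →
      IsNucleusIn G X K' → IsDiademIn G X D' →
      ∣ K ─ K' ∣ + ∣ nbhdIn G I (D ∩ NI) ∣ ≤ ∣ D' ∩ NI ∣
    ∣K─K'∣+∣N[D∩NI]∩I∣≤∣D'∩NI∣ {K} {D} {K'} K-nucleus D-diadem K'-nucleus D'-diadem = ≤-trans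
      (Disjoint⇒∣p∣+∣q∣≤∣r∣
        (⊆-∩ (nucleus─nucleus-in-X⊆nbhd K-nucleus K'-nucleus D'-diadem)
             (λ v∈K─K' → nucleus⊆maxCritical K-nucleus I-max (p─q⊆p K K' v∈K─K')))
        (∩-monoˡ-⊆ (nbhd-mono (∩-monoˡ-⊆ (diadem⊆diadem-in-X D-diadem D'-diadem))))
        λ v∈K─K' v∈N → nucleus-Disjoint-nbhd-diadem K-nucleus D-diadem (p─q⊆p K K' v∈K─K')
                          (nbhd-mono (p∩q⊆p D NI) (proj₁ (x∈p∩q⁻ _ _ v∈N))))
      (proj₂ (diadem-in-X⇒Tight D'-diadem))

lemma2p4 : ∀ {n : ℕ} (G : Graph n) (I : Subset n) →
    MaxCriticalIndepIn G ⊤ I →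
    ∀ (K D K' D' : Subset n) →
    IsNucleusIn G ⊤ K → IsDiademIn G ⊤ D →
    IsNucleusIn G (I ∪ nbhd G I) K' → IsDiademIn G (I ∪ nbhd G I) D' →
    ∣ K ∣ + ∣ D ∣ ≤ ∣ K' ∣ + ∣ D' ∣
lemma2p4 G I I-max K D K' D' K-nucleus D-diadem K'-nucleus D'-diadem = begin
  ∣ K ∣ + ∣ D ∣
    ≤⟨ +-mono-≤ ∣K∣≤∣K'∣+∣K─K'∣ (∣D∣≤∣I∣+∣D∩NI∣ D-diadem) ⟩
  (∣ K' ∣ + ∣ K ─ K' ∣) + (∣ I ∣ + ∣ P ∣)
    ≤⟨ +-monoʳ-≤ (∣ K' ∣ + ∣ K ─ K' ∣) (+-monoʳ-≤ (∣ I ∣) (hall (p∩q⊆q D NI))) ⟩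
  (∣ K' ∣ + ∣ K ─ K' ∣) + (∣ I ∣ + ∣ nbhdIn G I P ∣)
    ≡⟨ +-assoc (∣ K' ∣) (∣ K ─ K' ∣) _ ⟩
  ∣ K' ∣ + (∣ K ─ K' ∣ + (∣ I ∣ + ∣ nbhdIn G I P ∣))
    ≡⟨ cong (∣ K' ∣ +_) (x∙yz≈y∙xz (∣ K ─ K' ∣) (∣ I ∣) (∣ nbhdIn G I P ∣)) ⟩
  ∣ K' ∣ + (∣ I ∣ + (∣ K ─ K' ∣ + ∣ nbhdIn G I P ∣))
    ≤⟨ +-monoʳ-≤ (∣ K' ∣) (+-monoʳ-≤ (∣ I ∣)
         (∣K─K'∣+∣N[D∩NI]∩I∣≤∣D'∩NI∣ K-nucleus D-diadem K'-nucleus D'-diadem)) ⟩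
  ∣ K' ∣ + (∣ I ∣ + ∣ D' ∩ NI ∣)
    ≤⟨ +-monoʳ-≤ (∣ K' ∣) (∣I∣+∣D∩NI∣≤∣D∣ D'-diadem) ⟩
  ∣ K' ∣ + ∣ D' ∣ ∎
  where
  open ≤-Reasoning
  open MaximumCritical G I-max
  P = D ∩ NI
  ∣K∣≤∣K'∣+∣K─K'∣ : ∣ K ∣ ≤ ∣ K' ∣ + ∣ K ─ K' ∣
  ∣K∣≤∣K'∣+∣K─K'∣ = ≤-trans (∣p∣≤∣p∩q∣+∣p─q∣ K K') (+-monoˡ-≤ (∣ K ─ K' ∣) (∣p∩q∣≤∣q∣ K K'))
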